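{- For all integers $N\ge 0$ and $n\ge 1$, $$\widehat E_{N,n}=n!\sum_{k=1}^n(-1)^k\sum_{\substack{i_1,\dots,i_k\ge 1\\ i_1+\cdots+i_k=n/2}}\frac{\bigl((2N+1)!\bigr)^k}{(2N+2i_1+1)!\cdots(2N+2i_k+1)!}$$ and $$\widehat E_{N,n}=n!\sum_{k=1}^n(-1)^k\binom{n+1}{k+1}\sum_{\substack{i_1,\dots,i_k\ge 0\\ i_1+\cdots+i_k=n/2}}\frac{\bigl((2N+1)!\bigr)^k}{(2N+2i_1+1)!\cdots(2N+2i_k+1)!}.$$
   Context: For an integer $N\ge 0$, the complementary hypergeometric Euler numbers $\widehat E_{N,n}$ are defined by $$\frac{t^{2N+1}/(2N+1)!}{\sinh t-\sum_{m=0}^{N-1}t^{2m+1}/(2m+1)!}=\sum_{n=0}^\infty\widehat E_{N,n}\frac{t^n}{n!},$$ equivalently $1/\sum_{m\ge0}\frac{(2N+1)!}{(2N+2m+1)!}t^{2m}=\sum_n\widehat E_{N,n}t^n/n!$. The inner sums run over ordered $k$-tuples of integers; when $n$ is odd they are empty (value $0$). -}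

module Defs where

open import Data.Nat as ℕ using (ℕ; zero; suc; _!; _≟_; _≤?_; _%_)
open import Data.Nat.Properties using (_!≢0)
open import Data.Nat.Combinatorics using (_C_)
open import Data.Integer using (+_)
open import Data.Rational using (ℚ; 0ℚ; 1ℚ; _+_; _*_; -_; _/_)
open import Data.List using (List; []; _∷_; map; filter; upTo; concatMap; zipWith; foldr; head; length)
open import Data.List.Relation.Unary.All using (All; all?)
open import Data.Maybe using (fromMaybe)
open import Data.Bool using (if_then_else_)
open import Relation.Nullary.Decidable using (_×-dec_)

Σℚ : List ℚ → ℚ
Σℚ = foldr _+_ 0ℚ

Πℚ : List ℚ → ℚ
Πℚ = foldr _*_ 1ℚ

sgn : ℕ → ℚ
sgn zero    = 1ℚ
sgn (suc k) = - sgn k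

range1 : ℕ → List ℕ
range1 n = map suc (upTo n)

a : ℕ → ℕ → ℚ
a N m = _/_ (+ ((2 ℕ.* N ℕ.+ 1) !)) ((2 ℕ.* N ℕ.+ 2 ℕ.* m ℕ.+ 1) !)
          {{ (2 ℕ.* N ℕ.+ 2 ℕ.* m ℕ.+ 1) !≢0 }}

-- coefficient of t^j in  f_N(t) = Σ_m a N m t^(2m)
c : ℕ → ℕ → ℚ
c N j = if (j % 2 ℕ.≡ᵇ 0) then a N (j ℕ./ 2) else 0ℚ

-- Coefficients b_j of the reciprocal power series 1/f_N(t) = Σ b_j t^j,
-- determined by b_0 = 1 and Σ_{j=0}^{n} c_j b_{n-j} = 0 for n ≥ 1 (c_0 = 1).
-- bs N n = [b_n, b_{n-1}, ..., b_0].
bs : ℕ → ℕ → List ℚ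
bs N zero    = 1ℚ ∷ []
bs N (suc n) = (- Σℚ (zipWith _*_ (map (c N) (range1 (suc n))) (bs N n))) ∷ bs N n

Ehat : ℕ → ℕ → ℚ
Ehat N n = (+ (n !) / 1) * fromMaybe 0ℚ (head (bs N n))

tuples : ℕ → ℕ → List (List ℕ)
tuples zero    m = [] ∷ []
tuples (suc k) m = concatMap (λ i → map (i ∷_) (tuples k m)) (upTo (suc m))

sumℕ : List ℕ → ℕ
sumℕ = foldr ℕ._+_ 0

-- ordered k-tuples (i_1..i_k), i_j ≥ 1, with i_1+...+i_k = n/2 (i.e. 2·Σ = n;
-- empty when n is odd).  Entries are automatically ≤ n.
posTuples : ℕ → ℕ → List (List ℕ)
posTuples k n = filter (λ t → (2 ℕ.* sumℕ t ≟ n) ×-dec all? (1 ≤?_) t) (tuples k n)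

natTuples : ℕ → ℕ → List (List ℕ)
natTuples k n = filter (λ t → 2 ℕ.* sumℕ t ≟ n) (tuples k n)

term : ℕ → List ℕ → ℚ
term N t = Πℚ (map (a N) t)

rhs₁ : ℕ → ℕ → ℚ
rhs₁ N n = (+ (n !) / 1) *
  Σℚ (map (λ k → sgn k * Σℚ (map (term N) (posTuples k n))) (range1 n))

rhs₂ : ℕ → ℕ → ℚ
rhs₂ N n = (+ (n !) / 1) *
  Σℚ (map (λ k → sgn k * ((+ (suc n C suc k) / 1) * Σℚ (map (term N) (natTuples k n)))) (range1 n))

{-# OPTIONS --safe #-}
module Submission where

-- With a_m = (2N+1)!/(2N+2m+1)! put f(t) = Σ_m a_m t^(2m) = 1 + g(t) and 1/f = Σ_n b_n t^n, so that
-- Ê_{N,n} = n! b_n.  Since multiplication by g is the operator conv below and the tuple sums P_k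
-- over positive parts satisfy P_{k+1} = conv P_k, the alternating sum Σ_k (-1)^k P_k obeys the
-- recurrence defining b, which is the first formula.  For the second, the sums Z_k over tuples
-- with parts ≥ 0 are the coefficients of f^k = (1 + g)^k = Σ_j C(k,j) g^j, and the identity
-- Σ_k (-1)^k C(n+1,k+1) C(k,j) = (-1)^j for j ≤ n reduces it to the first.

open import Defs
open import Data.Nat using (ℕ; _≤_)
open import Data.Product using (_×_)
open import Relation.Binary.PropositionalEquality using (_≡_)

open import Algebra.Bundles using (CommutativeRing)
open import Data.Empty using (⊥-elim)
open import Data.Fin.Base using (toℕ)
open import Data.Fin.Properties using (toℕ<n; toℕ-inject₁; toℕ-fromℕ)
import Data.Integer as ℤ
import Data.Integer.Properties as ℤ
open import Data.List using (List; []; _∷_; _++_; map; concat; filter; zipWith; head; applyUpTo; applyDownFrom; upTo)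
open import Data.List.Properties using (map-∘; map-++; map-upTo; map-cong)
open import Data.List.Relation.Unary.All using (all?; _∷_)
open import Data.Maybe using (fromMaybe)
open import Data.Nat as ℕ using (suc; zero; _<_; _∸_; _≟_; _≤?_; z≤n; s≤s; ⌊_/2⌋; _!)
open import Data.Nat.Combinatorics using (_C_; nCk+nC[k+1]≡[n+1]C[k+1]; k>n⇒nCk≡0)
open import Data.Nat.Coprimality as Coprime using (1-coprimeTo)
import Data.Nat.DivMod as ℕ
import Data.Nat.Properties as ℕ
open import Data.Nat.Properties using (_!≢0)
open import Data.Product using (_,_)
open import Data.Rational using (ℚ; mkℚ; 0ℚ; 1ℚ; _+_; _*_; -_; _/_)
import Data.Rational.Properties as ℚ
open import Data.Rational.Unnormalised using (mkℚᵘ; *≡*)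
open import Data.Sum using (inj₁; inj₂)
open import Function using (_∘_; _⇔_; mk⇔; Equivalence)
open import Level using (0ℓ)
open import Relation.Binary.PropositionalEquality using (refl; sym; trans; cong; cong₂; subst; module ≡-Reasoning)
open import Relation.Nullary using (Dec; yes; no; ¬_)
open import Relation.Nullary.Decidable using (dec⇒maybe; _×-dec_)
open import Relation.Unary using (Decidable)
open import Tactic.RingSolver using (solve-∀)
open import Tactic.RingSolver.Core.AlmostCommutativeRing using (AlmostCommutativeRing; fromCommutativeRing)

open import Algebra.Properties.Semiring.Sum (CommutativeRing.semiring ℚ.+-*-commutativeRing)
  using (sum; sum-cong-≗; ∑-distrib-+; ∑-comm; *-distribˡ-sum; *-distribʳ-sum; sum-replicate-zero; sum-init-last)

ℚ-ring : AlmostCommutativeRing 0ℓ 0ℓ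
ℚ-ring = fromCommutativeRing ℚ.+-*-commutativeRing (λ x → dec⇒maybe (0ℚ ℚ.≟ x))

m+n≡o⇔n≡o∸m : ∀ {m n o} → m ≤ o → (m ℕ.+ n ≡ o) ⇔ (n ≡ o ∸ m)
m+n≡o⇔n≡o∸m {m} {n} m≤o = mk⇔
  (λ m+n≡o → trans (sym (ℕ.m+n∸m≡n m n)) (cong (_∸ m) m+n≡o))
  (λ n≡o∸m → trans (cong (m ℕ.+_) n≡o∸m) (ℕ.m+[n∸m]≡n m≤o))

2*m≤n⇒m≤⌊n/2⌋ : ∀ m n → 2 ℕ.* m ≤ n → m ≤ ⌊ n /2⌋
2*m≤n⇒m≤⌊n/2⌋ zero    n _ = z≤n
2*m≤n⇒m≤⌊n/2⌋ (suc m) n 2m≤n with subst (_≤ n) (ℕ.*-suc 2 m) 2m≤n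
... | s≤s (s≤s 2m≤n′) = s≤s (2*m≤n⇒m≤⌊n/2⌋ m _ 2m≤n′)

m≤⌊n/2⌋⇒2*m≤n : ∀ m n → m ≤ ⌊ n /2⌋ → 2 ℕ.* m ≤ n
m≤⌊n/2⌋⇒2*m≤n zero    n             _         = z≤n
m≤⌊n/2⌋⇒2*m≤n (suc m) (suc (suc n)) (s≤s m≤) =
  subst (_≤ suc (suc n)) (sym (ℕ.*-suc 2 m)) (s≤s (s≤s (m≤⌊n/2⌋⇒2*m≤n m n m≤)))

-- Opaque, so that unification sees ∑ n f rather than a sum over Fin n.
opaque
  ∑ : ℕ → (ℕ → ℚ) → ℚ
  ∑ n f = sum {n} (λ i → f (toℕ i))

  ∑-empty : ∀ (f : ℕ → ℚ) → ∑ 0 f ≡ 0ℚ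
  ∑-empty f = refl

  ∑-suc : ∀ n (f : ℕ → ℚ) → ∑ (suc n) f ≡ f 0 + ∑ n (f ∘ suc)
  ∑-suc n f = refl

  ∑-cong : ∀ n {f g : ℕ → ℚ} → (∀ i → i < n → f i ≡ g i) → ∑ n f ≡ ∑ n g
  ∑-cong n f≡g = sum-cong-≗ {n} (λ i → f≡g (toℕ i) (toℕ<n i))

  ∑-zero : ∀ n → ∑ n (λ _ → 0ℚ) ≡ 0ℚ
  ∑-zero = sum-replicate-zero

  ∑-init-last : ∀ n f → ∑ (suc n) f ≡ ∑ n f + f n
  ∑-init-last n f = trans (sum-init-last {n} (λ i → f (toℕ i)))
    (cong₂ _+_ (sum-cong-≗ {n} (cong f ∘ toℕ-inject₁)) (cong f (toℕ-fromℕ n)))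

  ∑-+ : ∀ n (f g : ℕ → ℚ) → ∑ n (λ i → f i + g i) ≡ ∑ n f + ∑ n g
  ∑-+ n f g = ∑-distrib-+ {n} (λ i → f (toℕ i)) (λ i → g (toℕ i))

  ∑-swap : ∀ m n (f : ℕ → ℕ → ℚ) → ∑ m (λ i → ∑ n (f i)) ≡ ∑ n (λ j → ∑ m (λ i → f i j))
  ∑-swap m n f = ∑-comm {m} {n} (λ i j → f (toℕ i) (toℕ j))

  *-distribˡ-∑ : ∀ n x (f : ℕ → ℚ) → x * ∑ n f ≡ ∑ n (λ i → x * f i)
  *-distribˡ-∑ n x f = *-distribˡ-sum {n} x (λ i → f (toℕ i))

  *-distribʳ-∑ : ∀ n x (f : ℕ → ℚ) → ∑ n f * x ≡ ∑ n (λ i → f i * x)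
  *-distribʳ-∑ n x f = *-distribʳ-sum {n} x (λ i → f (toℕ i))

syntax ∑ n (λ i → e) = ∑[ i < n ] e

∑-cong′ : ∀ n {f g : ℕ → ℚ} → (∀ i → f i ≡ g i) → ∑ n f ≡ ∑ n g
∑-cong′ n f≡g = ∑-cong n (λ i _ → f≡g i)

-‿distrib-∑ : ∀ n (f : ℕ → ℚ) → - ∑ n f ≡ ∑[ i < n ] (- f i)
-‿distrib-∑ zero    f = trans (cong -_ (∑-empty f)) (sym (∑-empty _))
-‿distrib-∑ (suc n) f = begin
  - ∑ (suc n) f                ≡⟨ cong -_ (∑-suc n f) ⟩
  - (f 0 + ∑ n (f ∘ suc))      ≡⟨ ℚ.neg-distrib-+ (f 0) _ ⟩
  - f 0 + - ∑ n (f ∘ suc)      ≡⟨ cong (- f 0 +_) (-‿distrib-∑ n (f ∘ suc)) ⟩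
  - f 0 + ∑[ i < n ] (- f (suc i)) ≡⟨ sym (∑-suc n _) ⟩
  ∑[ i < suc n ] (- f i)       ∎
  where open ≡-Reasoning

∑-truncate : ∀ {k n} (f : ℕ → ℚ) → k ≤ n → (∀ i → k ≤ i → i < n → f i ≡ 0ℚ) → ∑ n f ≡ ∑ k f
∑-truncate {n = zero} f z≤n _ = refl
∑-truncate {k} {suc n} f k≤1+n f≡0 with ℕ.m≤n⇒m<n∨m≡n k≤1+n
... | inj₂ refl = refl
... | inj₁ (s≤s k≤n) = begin
  ∑ (suc n) f   ≡⟨ ∑-init-last n f ⟩
  ∑ n f + f n   ≡⟨ cong₂ _+_ (∑-truncate f k≤n (λ i k≤i i<n → f≡0 i k≤i (ℕ.m<n⇒m<1+n i<n))) (f≡0 n k≤n ℕ.≤-refl) ⟩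
  ∑ k f + 0ℚ    ≡⟨ ℚ.+-identityʳ _ ⟩
  ∑ k f         ∎
  where open ≡-Reasoning

∑-drop-first : ∀ n (f : ℕ → ℚ) → f 0 ≡ 0ℚ → ∑ (suc n) f ≡ ∑[ k < n ] f (suc k)
∑-drop-first n f f0≡0 = trans (∑-suc n f) (trans (cong (_+ ∑ n (f ∘ suc)) f0≡0) (ℚ.+-identityˡ _))

∑-odd-vanishing : ∀ s (h : ℕ → ℚ) → (∀ q → h (suc (2 ℕ.* q)) ≡ 0ℚ) →
                  ∑[ j < s ] h (suc j) ≡ ∑[ i < ⌊ s /2⌋ ] h (2 ℕ.* suc i)
∑-odd-vanishing zero          h h-odd = trans (∑-empty _) (sym (∑-empty _))
∑-odd-vanishing (suc zero)    h h-odd = begin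
  ∑[ j < 1 ] h (suc j)   ≡⟨ ∑-suc 0 _ ⟩
  h 1 + ∑ 0 _            ≡⟨ cong₂ _+_ (h-odd 0) (∑-empty _) ⟩
  0ℚ                     ≡⟨ sym (∑-empty _) ⟩
  ∑ 0 _                  ∎
  where open ≡-Reasoning
∑-odd-vanishing (suc (suc s)) h h-odd = begin
  ∑[ j < suc (suc s) ] h (suc j)
    ≡⟨ trans (∑-suc (suc s) _) (cong (h 1 +_) (∑-suc s _)) ⟩
  h 1 + (h 2 + ∑[ j < s ] h (suc (suc (suc j))))
    ≡⟨ cong₂ (λ x y → x + (h 2 + y)) (h-odd 0) (∑-odd-vanishing s (h ∘ suc ∘ suc) h′-odd) ⟩
  0ℚ + (h 2 + ∑[ i < ⌊ s /2⌋ ] h (suc (suc (2 ℕ.* suc i))))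
    ≡⟨ ℚ.+-identityˡ _ ⟩
  h 2 + ∑[ i < ⌊ s /2⌋ ] h (suc (suc (2 ℕ.* suc i)))
    ≡⟨ cong (h 2 +_) (∑-cong′ ⌊ s /2⌋ (λ i → cong h (sym (ℕ.*-suc 2 (suc i))))) ⟩
  h 2 + ∑[ i < ⌊ s /2⌋ ] h (2 ℕ.* suc (suc i))
    ≡⟨ sym (∑-suc ⌊ s /2⌋ _) ⟩
  ∑[ i < suc ⌊ s /2⌋ ] h (2 ℕ.* suc i)
    ∎
  where
  open ≡-Reasoning
  h′-odd : ∀ q → h (suc (suc (suc (2 ℕ.* q)))) ≡ 0ℚ
  h′-odd q = trans (cong (h ∘ suc) (sym (ℕ.*-suc 2 q))) (h-odd (suc q))

when : {P : Set} → Dec P → ℚ → ℚ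
when (yes _) x = x
when (no _)  _ = 0ℚ

when-yes : ∀ {P : Set} (d : Dec P) {x} → P → when d x ≡ x
when-yes (yes _) _ = refl
when-yes (no ¬p) p = ⊥-elim (¬p p)

when-no : ∀ {P : Set} (d : Dec P) {x} → ¬ P → when d x ≡ 0ℚ
when-no (yes p) ¬p = ⊥-elim (¬p p)
when-no (no _)  _  = refl

when-⇔ : ∀ {P Q : Set} (d : Dec P) (e : Dec Q) {x} → P ⇔ Q → when d x ≡ when e x
when-⇔ (yes p) e P⇔Q = sym (when-yes e (Equivalence.to P⇔Q p))
when-⇔ (no ¬p) e P⇔Q = sym (when-no e (¬p ∘ Equivalence.from P⇔Q))

when-× : ∀ {P Q : Set} (d : Dec P) (e : Dec Q) x → when (d ×-dec e) x ≡ when d (when e x)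
when-× (yes _) (yes _) x = refl
when-× (yes _) (no _)  x = refl
when-× (no _)  _       x = refl

*-when : ∀ {P : Set} (d : Dec P) x y → x * when d y ≡ when d (x * y)
*-when (yes _) x y = refl
*-when (no _)  x y = ℚ.*-zeroʳ x

-‿when : ∀ {P : Set} (d : Dec P) x → - when d x ≡ when d (- x)
-‿when (yes _) x = refl
-‿when (no _)  x = refl

∑-when : ∀ {P : Set} (d : Dec P) n (f : ℕ → ℚ) → ∑[ i < n ] when d (f i) ≡ when d (∑ n f)
∑-when (yes _) n f = refl
∑-when (no _)  n f = ∑-zero n

∑-δ : ∀ {j n} x → j < n → ∑[ i < n ] when (i ≟ j) x ≡ x
∑-δ {j} {n} x j<n = begin
  ∑[ i < n ] when (i ≟ j) x
    ≡⟨ ∑-truncate _ j<n (λ i j<i _ → when-no (i ≟ j) (ℕ.>⇒≢ j<i)) ⟩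
  ∑[ i < suc j ] when (i ≟ j) x
    ≡⟨ ∑-init-last j _ ⟩
  ∑[ i < j ] when (i ≟ j) x + when (j ≟ j) x
    ≡⟨ cong₂ _+_ (∑-cong j (λ i i<j → when-no (i ≟ j) (ℕ.<⇒≢ i<j))) (when-yes (j ≟ j) refl) ⟩
  ∑[ i < j ] 0ℚ + x
    ≡⟨ cong (_+ x) (∑-zero j) ⟩
  0ℚ + x
    ≡⟨ ℚ.+-identityˡ x ⟩
  x
    ∎
  where open ≡-Reasoning

∑-when-< : ∀ {q m} (f : ℕ → ℚ) → q ≤ m → ∑[ i < m ] when (i ℕ.<? q) (f i) ≡ ∑ q f
∑-when-< {q} f q≤m = begin
  ∑[ i < _ ] when (i ℕ.<? q) (f i) ≡⟨ ∑-truncate _ q≤m (λ i q≤i _ → when-no (i ℕ.<? q) (ℕ.≤⇒≯ q≤i)) ⟩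
  ∑[ i < q ] when (i ℕ.<? q) (f i) ≡⟨ ∑-cong q (λ i i<q → when-yes (i ℕ.<? q) i<q) ⟩
  ∑ q f                            ∎
  where open ≡-Reasoning

∑-when-double≤ : ∀ m s (g : ℕ → ℚ) → ⌊ s /2⌋ ≤ m →
                 ∑[ i < m ] when (2 ℕ.* suc i ≤? s) (g i) ≡ ∑[ i < ⌊ s /2⌋ ] g i
∑-when-double≤ m s g ⌊s/2⌋≤m = begin
  ∑[ i < m ] when (2 ℕ.* suc i ≤? s) (g i) ≡⟨ ∑-cong′ m (λ i → when-⇔ (2 ℕ.* suc i ≤? s) (i ℕ.<? ⌊ s /2⌋)
                                                 (mk⇔ (2*m≤n⇒m≤⌊n/2⌋ (suc i) s) (m≤⌊n/2⌋⇒2*m≤n (suc i) s))) ⟩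
  ∑[ i < m ] when (i ℕ.<? ⌊ s /2⌋) (g i)  ≡⟨ ∑-when-< g ⌊s/2⌋≤m ⟩
  ∑[ i < ⌊ s /2⌋ ] g i                    ∎
  where open ≡-Reasoning

when-double-+ : ∀ i x s y → when (2 ℕ.* (i ℕ.+ x) ≟ s) y ≡ when (2 ℕ.* i ≤? s) (when (2 ℕ.* x ≟ s ∸ 2 ℕ.* i) y)
when-double-+ i x s y with 2 ℕ.* i ≤? s
... | yes 2i≤s = when-⇔ (2 ℕ.* (i ℕ.+ x) ≟ s) (2 ℕ.* x ≟ s ∸ 2 ℕ.* i)
                   (subst (λ z → (z ≡ s) ⇔ (2 ℕ.* x ≡ s ∸ 2 ℕ.* i)) (sym (ℕ.*-distribˡ-+ 2 i x)) (m+n≡o⇔n≡o∸m 2i≤s))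
... | no 2i≰s  = when-no (2 ℕ.* (i ℕ.+ x) ≟ s)
                   (λ eq → 2i≰s (subst (2 ℕ.* i ≤_) eq (ℕ.*-monoʳ-≤ 2 (ℕ.m≤m+n i x))))

Σℚ-++ : ∀ xs ys → Σℚ (xs ++ ys) ≡ Σℚ xs + Σℚ ys
Σℚ-++ []       ys = sym (ℚ.+-identityˡ _)
Σℚ-++ (x ∷ xs) ys = trans (cong (x +_) (Σℚ-++ xs ys)) (sym (ℚ.+-assoc x _ _))

Σℚ-concat : ∀ {A : Set} (F : A → ℚ) xss → Σℚ (map F (concat xss)) ≡ Σℚ (map (λ xs → Σℚ (map F xs)) xss)
Σℚ-concat F []         = refl
Σℚ-concat F (xs ∷ xss) = begin
  Σℚ (map F (xs ++ concat xss))         ≡⟨ cong Σℚ (map-++ F xs (concat xss)) ⟩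
  Σℚ (map F xs ++ map F (concat xss))   ≡⟨ Σℚ-++ (map F xs) _ ⟩
  Σℚ (map F xs) + Σℚ (map F (concat xss)) ≡⟨ cong (Σℚ (map F xs) +_) (Σℚ-concat F xss) ⟩
  Σℚ (map F xs) + Σℚ (map (λ xs → Σℚ (map F xs)) xss) ∎
  where open ≡-Reasoning

Σℚ-applyUpTo : ∀ n (f : ℕ → ℚ) → Σℚ (applyUpTo f n) ≡ ∑ n f
Σℚ-applyUpTo zero    f = sym (∑-empty f)
Σℚ-applyUpTo (suc n) f = trans (cong (f 0 +_) (Σℚ-applyUpTo n (f ∘ suc))) (sym (∑-suc n f))

Σℚ-filter : ∀ {A : Set} {P : A → Set} (P? : Decidable P) (F : A → ℚ) xs →
            Σℚ (map F (filter P? xs)) ≡ Σℚ (map (λ x → when (P? x) (F x)) xs)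
Σℚ-filter P? F []       = refl
Σℚ-filter P? F (x ∷ xs) with P? x
... | yes _ = cong (F x +_) (Σℚ-filter P? F xs)
... | no _  = trans (Σℚ-filter P? F xs) (sym (ℚ.+-identityˡ _))

*-distribˡ-Σℚ : ∀ {A : Set} x (F : A → ℚ) xs → x * Σℚ (map F xs) ≡ Σℚ (map (λ a → x * F a) xs)
*-distribˡ-Σℚ x F []       = ℚ.*-zeroʳ x
*-distribˡ-Σℚ x F (a ∷ xs) = trans (ℚ.*-distribˡ-+ x (F a) _) (cong (x * F a +_) (*-distribˡ-Σℚ x F xs))

Σℚ-when : ∀ {A : Set} {P : Set} (d : Dec P) (F : A → ℚ) xs →
          Σℚ (map (λ a → when d (F a)) xs) ≡ when d (Σℚ (map F xs))
Σℚ-when (yes _) F xs = refl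
Σℚ-when (no _)  F []       = refl
Σℚ-when (no ¬p) F (a ∷ xs) = trans (ℚ.+-identityˡ _) (Σℚ-when (no ¬p) F xs)

Σℚ-tuples-suc : ∀ k m (F : List ℕ → ℚ) →
                Σℚ (map F (tuples (suc k) m)) ≡ ∑[ i < suc m ] Σℚ (map (F ∘ (i ∷_)) (tuples k m))
Σℚ-tuples-suc k m F = begin
  Σℚ (map F (concat (map rows (upTo (suc m)))))
    ≡⟨ Σℚ-concat F (map rows (upTo (suc m))) ⟩
  Σℚ (map (λ xs → Σℚ (map F xs)) (map rows (upTo (suc m))))
    ≡⟨ cong Σℚ (sym (map-∘ {g = λ xs → Σℚ (map F xs)} {f = rows} (upTo (suc m)))) ⟩
  Σℚ (map (λ i → Σℚ (map F (rows i))) (upTo (suc m)))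
    ≡⟨ cong Σℚ (map-upTo (λ i → Σℚ (map F (rows i))) (suc m)) ⟩
  Σℚ (applyUpTo (λ i → Σℚ (map F (rows i))) (suc m))
    ≡⟨ Σℚ-applyUpTo (suc m) _ ⟩
  ∑[ i < suc m ] Σℚ (map F (rows i))
    ≡⟨ ∑-cong′ (suc m) (λ i → cong Σℚ (sym (map-∘ (tuples k m)))) ⟩
  ∑[ i < suc m ] Σℚ (map (F ∘ (i ∷_)) (tuples k m))
    ∎
  where
  open ≡-Reasoning
  rows : ℕ → List (List ℕ)
  rows i = map (i ∷_) (tuples k m)

Σℚ-range1 : ∀ n (F : ℕ → ℚ) → Σℚ (map F (range1 n)) ≡ ∑[ k < n ] F (suc k)
Σℚ-range1 n F = begin
  Σℚ (map F (map suc (upTo n))) ≡⟨ cong Σℚ (sym (map-∘ (upTo n))) ⟩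
  Σℚ (map (F ∘ suc) (upTo n))   ≡⟨ cong Σℚ (map-upTo (F ∘ suc) n) ⟩
  Σℚ (applyUpTo (F ∘ suc) n)    ≡⟨ Σℚ-applyUpTo n (F ∘ suc) ⟩
  ∑[ k < n ] F (suc k)          ∎
  where open ≡-Reasoning

-- Binomial coefficients and the binomial transform

ι : ℕ → ℚ
ι n = ℤ.+ n / 1

ι≡mkℚ : ∀ n → ι n ≡ mkℚ (ℤ.+ n) 0 (Coprime.sym (1-coprimeTo n))
ι≡mkℚ n = ℚ.normalize-coprime (Coprime.sym (1-coprimeTo n))

ι-+ : ∀ m n → ι (m ℕ.+ n) ≡ ι m + ι n
ι-+ m n = begin
  ℤ.+ (m ℕ.+ n) / 1
    ≡⟨ ℚ./-cong (trans (ℤ.pos-+ m n) (sym (cong₂ ℤ._+_ (ℤ.*-identityʳ (ℤ.+ m)) (ℤ.*-identityʳ (ℤ.+ n))))) refl ⟩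
  (ℤ.+ m ℤ.* ℤ.+ 1 ℤ.+ ℤ.+ n ℤ.* ℤ.+ 1) / 1
    ≡⟨ sym (cong₂ _+_ (ι≡mkℚ m) (ι≡mkℚ n)) ⟩
  ι m + ι n
    ∎
  where open ≡-Reasoning

n/n≡1 : ∀ n .{{_ : ℕ.NonZero n}} → ℤ.+ n / n ≡ 1ℚ
n/n≡1 (suc n) = ℚ.fromℚᵘ-cong {mkℚᵘ (ℤ.+ suc n) n} {mkℚᵘ (ℤ.+ 1) 0}
  (*≡* (trans (ℤ.*-identityʳ (ℤ.+ suc n)) (sym (ℤ.*-identityˡ (ℤ.+ suc n)))))

Cℚ : ℕ → ℕ → ℚ
Cℚ n k = ι (n C k)

Cℚ-pascal : ∀ n k → Cℚ (suc n) (suc k) ≡ Cℚ n k + Cℚ n (suc k)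
Cℚ-pascal n k = trans (cong ι (sym (nCk+nC[k+1]≡[n+1]C[k+1] n k))) (ι-+ (n C k) (n C suc k))

Cℚ-> : ∀ {n k} → n < k → Cℚ n k ≡ 0ℚ
Cℚ-> n<k = cong ι (k>n⇒nCk≡0 n<k)

binomialTransform : (ℕ → ℚ) → ℕ → ℚ
binomialTransform X n = ∑[ k < suc n ] (Cℚ n k * X k)

binomialTransform-zero : ∀ X → binomialTransform X 0 ≡ X 0
binomialTransform-zero X = begin
  ∑[ k < 1 ] (Cℚ 0 k * X k)   ≡⟨ ∑-suc 0 _ ⟩
  1ℚ * X 0 + ∑ 0 _            ≡⟨ cong₂ _+_ (ℚ.*-identityˡ (X 0)) (∑-empty _) ⟩
  X 0 + 0ℚ                    ≡⟨ ℚ.+-identityʳ (X 0) ⟩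
  X 0                         ∎
  where open ≡-Reasoning

binomialTransform-+ : ∀ X Y n → binomialTransform (λ k → X k + Y k) n ≡ binomialTransform X n + binomialTransform Y n
binomialTransform-+ X Y n =
  trans (∑-cong′ (suc n) (λ k → ℚ.*-distribˡ-+ (Cℚ n k) (X k) (Y k))) (∑-+ (suc n) _ _)

binomialTransform-neg : ∀ X n → binomialTransform (λ k → - X k) n ≡ - binomialTransform X n
binomialTransform-neg X n =
  trans (∑-cong′ (suc n) (λ k → sym (ℚ.neg-distribʳ-* (Cℚ n k) (X k)))) (sym (-‿distrib-∑ (suc n) _))

binomialTransform-suc : ∀ X n → binomialTransform X (suc n) ≡ binomialTransform X n + binomialTransform (X ∘ suc) n
binomialTransform-suc X n = begin
  ∑[ k < suc (suc n) ] (Cℚ (suc n) k * X k)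
    ≡⟨ ∑-suc (suc n) _ ⟩
  1ℚ * X 0 + ∑[ k < suc n ] (Cℚ (suc n) (suc k) * X (suc k))
    ≡⟨ cong (1ℚ * X 0 +_) (trans (∑-cong′ (suc n) pascal) (∑-+ (suc n) _ _)) ⟩
  1ℚ * X 0 + (binomialTransform (X ∘ suc) n + ∑[ k < suc n ] (Cℚ n (suc k) * X (suc k)))
    ≡⟨ cong (λ z → 1ℚ * X 0 + (binomialTransform (X ∘ suc) n + z)) (∑-init-last n _) ⟩
  1ℚ * X 0 + (binomialTransform (X ∘ suc) n + (tail + Cℚ n (suc n) * X (suc n)))
    ≡⟨ cong (λ z → 1ℚ * X 0 + (binomialTransform (X ∘ suc) n + (tail + z * X (suc n)))) (Cℚ-> (ℕ.n<1+n n)) ⟩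
  1ℚ * X 0 + (binomialTransform (X ∘ suc) n + (tail + 0ℚ * X (suc n)))
    ≡⟨ rearrange (X 0) (binomialTransform (X ∘ suc) n) tail (X (suc n)) ⟩
  (1ℚ * X 0 + tail) + binomialTransform (X ∘ suc) n
    ≡⟨ cong (_+ binomialTransform (X ∘ suc) n) (sym (∑-suc n _)) ⟩
  binomialTransform X n + binomialTransform (X ∘ suc) n
    ∎
  where
  open ≡-Reasoning
  tail : ℚ
  tail = ∑[ k < n ] (Cℚ n (suc k) * X (suc k))
  pascal : ∀ k → Cℚ (suc n) (suc k) * X (suc k) ≡ Cℚ n k * X (suc k) + Cℚ n (suc k) * X (suc k)
  pascal k = trans (cong (_* X (suc k)) (Cℚ-pascal n k)) (ℚ.*-distribʳ-+ (X (suc k)) (Cℚ n k) (Cℚ n (suc k)))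
  rearrange : ∀ x b t y → 1ℚ * x + (b + (t + 0ℚ * y)) ≡ (1ℚ * x + t) + b
  rearrange = solve-∀ ℚ-ring

binomialTransform-telescope : ∀ X n → binomialTransform X n ≡ X 0 + ∑[ p < n ] binomialTransform (X ∘ suc) p
binomialTransform-telescope X zero = begin
  binomialTransform X 0 ≡⟨ binomialTransform-zero X ⟩
  X 0                   ≡⟨ sym (ℚ.+-identityʳ (X 0)) ⟩
  X 0 + 0ℚ              ≡⟨ cong (X 0 +_) (sym (∑-empty _)) ⟩
  X 0 + ∑ 0 _           ∎
  where open ≡-Reasoning
binomialTransform-telescope X (suc n) = begin
  binomialTransform X (suc n)
    ≡⟨ binomialTransform-suc X n ⟩
  binomialTransform X n + binomialTransform (X ∘ suc) n
    ≡⟨ cong (_+ binomialTransform (X ∘ suc) n) (binomialTransform-telescope X n) ⟩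
  X 0 + ∑[ p < n ] binomialTransform (X ∘ suc) p + binomialTransform (X ∘ suc) n
    ≡⟨ ℚ.+-assoc (X 0) _ _ ⟩
  X 0 + (∑[ p < n ] binomialTransform (X ∘ suc) p + binomialTransform (X ∘ suc) n)
    ≡⟨ cong (X 0 +_) (sym (∑-init-last n _)) ⟩
  X 0 + ∑[ p < suc n ] binomialTransform (X ∘ suc) p
    ∎
  where open ≡-Reasoning

binomialTransform-cong : ∀ {X Y} n → (∀ k → X k ≡ Y k) → binomialTransform X n ≡ binomialTransform Y n
binomialTransform-cong n X≡Y = ∑-cong′ (suc n) (λ k → cong (Cℚ n k *_) (X≡Y k))

binomialTransform-alternating : ∀ p j → binomialTransform (λ k → sgn k * Cℚ k j) p ≡ when (p ≟ j) (sgn j)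
binomialTransform-alternating zero j = begin
  binomialTransform (λ k → sgn k * Cℚ k j) 0 ≡⟨ binomialTransform-zero _ ⟩
  1ℚ * Cℚ 0 j                                ≡⟨ ℚ.*-identityˡ (Cℚ 0 j) ⟩
  Cℚ 0 j                                     ≡⟨ base j ⟩
  when (0 ≟ j) (sgn j)                       ∎
  where
  open ≡-Reasoning
  base : ∀ j → Cℚ 0 j ≡ when (0 ≟ j) (sgn j)
  base zero    = refl
  base (suc j) = trans (Cℚ-> {0} {suc j} (s≤s z≤n)) (sym (when-no (0 ≟ suc j) {sgn (suc j)} (λ ())))
binomialTransform-alternating (suc p) zero = begin
  binomialTransform X (suc p)                      ≡⟨ binomialTransform-suc X p ⟩
  binomialTransform X p + binomialTransform (X ∘ suc) p
    ≡⟨ cong (binomialTransform X p +_) (trans (binomialTransform-cong p (λ k → sym (ℚ.neg-distribˡ-* (sgn k) 1ℚ)))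
                                            (binomialTransform-neg X p)) ⟩
  binomialTransform X p + - binomialTransform X p ≡⟨ ℚ.+-inverseʳ (binomialTransform X p) ⟩
  0ℚ                                               ≡⟨ sym (when-no (suc p ≟ 0) {sgn 0} (λ ())) ⟩
  when (suc p ≟ 0) (sgn 0)                         ∎
  where
  open ≡-Reasoning
  X : ℕ → ℚ
  X k = sgn k * Cℚ k 0
binomialTransform-alternating (suc p) (suc j) = begin
  binomialTransform (X (suc j)) (suc p)
    ≡⟨ binomialTransform-suc (X (suc j)) p ⟩
  binomialTransform (X (suc j)) p + binomialTransform (X (suc j) ∘ suc) p
    ≡⟨ cong (binomialTransform (X (suc j)) p +_) (trans (binomialTransform-cong p shift)
          (trans (binomialTransform-neg _ p) (cong -_ (binomialTransform-+ (X j) (X (suc j)) p)))) ⟩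
  binomialTransform (X (suc j)) p + - (binomialTransform (X j) p + binomialTransform (X (suc j)) p)
    ≡⟨ cancel (binomialTransform (X (suc j)) p) (binomialTransform (X j) p) ⟩
  - binomialTransform (X j) p                    ≡⟨ cong -_ (binomialTransform-alternating p j) ⟩
  - when (p ≟ j) (sgn j)                         ≡⟨ -‿when (p ≟ j) (sgn j) ⟩
  when (p ≟ j) (sgn (suc j))                     ≡⟨ when-⇔ (p ≟ j) (suc p ≟ suc j) (mk⇔ (cong suc) ℕ.suc-injective) ⟩
  when (suc p ≟ suc j) (sgn (suc j))             ∎
  where
  open ≡-Reasoning
  X : ℕ → ℕ → ℚ
  X j k = sgn k * Cℚ k j
  shift : ∀ k → X (suc j) (suc k) ≡ - (X j k + X (suc j) k)
  shift k = trans (cong (- sgn k *_) (Cℚ-pascal k j)) (distrib (sgn k) (Cℚ k j) (Cℚ k (suc j)))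
    where
    distrib : ∀ s a b → - s * (a + b) ≡ - (s * a + s * b)
    distrib = solve-∀ ℚ-ring
  cancel : ∀ a b → a + - (b + a) ≡ - b
  cancel = solve-∀ ℚ-ring

binomialTransform-extend : ∀ X {k n} → k ≤ n → binomialTransform X k ≡ ∑[ j < suc n ] (Cℚ k j * X j)
binomialTransform-extend X {k} {n} k≤n = sym (∑-truncate _ (s≤s k≤n) vanish)
  where
  vanish : ∀ j → suc k ≤ j → j < suc n → Cℚ k j * X j ≡ 0ℚ
  vanish j k<j _ = trans (cong (_* X j) (Cℚ-> k<j)) (ℚ.*-zeroˡ (X j))

-- Pascal's rule on C(n+1,k+1) telescopes the sum into Σ_{p ≤ n} Σ_k (-1)^k C(p,k) C(k,j),
-- whose inner sums vanish except for p = j.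
∑-alternating-binomial : ∀ {j n} → j ≤ n → ∑[ k < suc n ] (sgn k * Cℚ (suc n) (suc k) * Cℚ k j) ≡ sgn j
∑-alternating-binomial {j} {n} j≤n = begin
  ∑[ k < suc n ] (sgn k * Cℚ (suc n) (suc k) * Cℚ k j)
    ≡⟨ ∑-cong′ (suc n) (λ k → reorder (sgn k) (Cℚ (suc n) (suc k)) (Cℚ k j)) ⟩
  ∑[ k < suc n ] (Cℚ (suc n) (suc k) * Y (suc k))
    ≡⟨ sym (trans (cong (_+ rest) (ℚ.*-zeroʳ 1ℚ)) (ℚ.+-identityˡ rest)) ⟩
  1ℚ * Y 0 + ∑[ k < suc n ] (Cℚ (suc n) (suc k) * Y (suc k))
    ≡⟨ sym (∑-suc (suc n) _) ⟩
  binomialTransform Y (suc n)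
    ≡⟨ binomialTransform-telescope Y (suc n) ⟩
  0ℚ + ∑[ p < suc n ] binomialTransform (Y ∘ suc) p
    ≡⟨ ℚ.+-identityˡ _ ⟩
  ∑[ p < suc n ] binomialTransform (λ k → sgn k * Cℚ k j) p
    ≡⟨ ∑-cong′ (suc n) (λ p → binomialTransform-alternating p j) ⟩
  ∑[ p < suc n ] when (p ≟ j) (sgn j)
    ≡⟨ ∑-δ (sgn j) (s≤s j≤n) ⟩
  sgn j
    ∎
  where
  open ≡-Reasoning
  Y : ℕ → ℚ
  Y zero    = 0ℚ
  Y (suc k) = sgn k * Cℚ k j
  rest : ℚ
  rest = ∑[ k < suc n ] (Cℚ (suc n) (suc k) * Y (suc k))
  reorder : ∀ s a b → s * a * b ≡ a * (s * b)
  reorder = solve-∀ ℚ-ring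

-- Weighted sums over tuples

-- [t^s] (Σ_{i ≤ m} β i t^(2i))^k, as a sum over k-tuples.
compositionSum : (ℕ → ℚ) → ℕ → ℕ → ℕ → ℚ
compositionSum β m k s = Σℚ (map (λ t → Πℚ (map β t)) (filter (λ t → 2 ℕ.* sumℕ t ≟ s) (tuples k m)))

-- [t^s] (Σ_{1 ≤ i ≤ m} β i t^(2i)) · (Σ_r X r t^r).
conv : (ℕ → ℚ) → ℕ → (ℕ → ℚ) → ℕ → ℚ
conv β m X s = ∑[ i < m ] when (2 ℕ.* suc i ≤? s) (β (suc i) * X (s ∸ 2 ℕ.* suc i))

compositionSum-zero : ∀ β m s → compositionSum β m 0 s ≡ when (0 ≟ s) 1ℚ
compositionSum-zero β m s =
  trans (Σℚ-filter (λ t → 2 ℕ.* sumℕ t ≟ s) (λ t → Πℚ (map β t)) ([] ∷ [])) (ℚ.+-identityʳ _)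

compositionSum-zero-suc : ∀ β m s → compositionSum β m 0 (suc s) ≡ 0ℚ
compositionSum-zero-suc β m s = trans (compositionSum-zero β m (suc s)) (when-no (0 ≟ suc s) {1ℚ} (λ ()))

compositionSum-suc : ∀ β m k s →
  compositionSum β m (suc k) s ≡ β 0 * compositionSum β m k s + conv β m (compositionSum β m k) s
compositionSum-suc β m k s = begin
  compositionSum β m (suc k) s
    ≡⟨ Σℚ-filter (λ t → 2 ℕ.* sumℕ t ≟ s) Π (tuples (suc k) m) ⟩
  Σℚ (map (λ t → when (2 ℕ.* sumℕ t ≟ s) (Π t)) (tuples (suc k) m))
    ≡⟨ Σℚ-tuples-suc k m _ ⟩
  ∑[ i < suc m ] Σℚ (map (λ t → when (2 ℕ.* (i ℕ.+ sumℕ t) ≟ s) (β i * Π t)) (tuples k m))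
    ≡⟨ ∑-cong′ (suc m) row ⟩
  ∑[ i < suc m ] when (2 ℕ.* i ≤? s) (β i * compositionSum β m k (s ∸ 2 ℕ.* i))
    ≡⟨ ∑-suc m _ ⟩
  when (0 ≤? s) (β 0 * compositionSum β m k s) + conv β m (compositionSum β m k) s
    ≡⟨ cong (_+ conv β m (compositionSum β m k) s) (when-yes (0 ≤? s) {β 0 * compositionSum β m k s} z≤n) ⟩
  β 0 * compositionSum β m k s + conv β m (compositionSum β m k) s
    ∎
  where
  open ≡-Reasoning
  Π : List ℕ → ℚ
  Π t = Πℚ (map β t)
  row : ∀ i → Σℚ (map (λ t → when (2 ℕ.* (i ℕ.+ sumℕ t) ≟ s) (β i * Π t)) (tuples k m))
            ≡ when (2 ℕ.* i ≤? s) (β i * compositionSum β m k (s ∸ 2 ℕ.* i))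
  row i = begin
    Σℚ (map (λ t → when (2 ℕ.* (i ℕ.+ sumℕ t) ≟ s) (β i * Π t)) (tuples k m))
      ≡⟨ cong Σℚ (map-cong (λ t → trans (when-double-+ i (sumℕ t) s (β i * Π t))
                                        (cong (when (2 ℕ.* i ≤? s)) (sym (*-when (2 ℕ.* sumℕ t ≟ s′) (β i) (Π t)))))
                           (tuples k m)) ⟩
    Σℚ (map (λ t → when (2 ℕ.* i ≤? s) (β i * when (2 ℕ.* sumℕ t ≟ s′) (Π t))) (tuples k m))
      ≡⟨ Σℚ-when (2 ℕ.* i ≤? s) _ (tuples k m) ⟩
    when (2 ℕ.* i ≤? s) (Σℚ (map (λ t → β i * when (2 ℕ.* sumℕ t ≟ s′) (Π t)) (tuples k m)))
      ≡⟨ cong (when (2 ℕ.* i ≤? s)) (sym (*-distribˡ-Σℚ (β i) _ (tuples k m))) ⟩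
    when (2 ℕ.* i ≤? s) (β i * Σℚ (map (λ t → when (2 ℕ.* sumℕ t ≟ s′) (Π t)) (tuples k m)))
      ≡⟨ cong (λ z → when (2 ℕ.* i ≤? s) (β i * z)) (sym (Σℚ-filter (λ t → 2 ℕ.* sumℕ t ≟ s′) Π (tuples k m))) ⟩
    when (2 ℕ.* i ≤? s) (β i * compositionSum β m k s′)
      ∎
    where
    s′ : ℕ
    s′ = s ∸ 2 ℕ.* i

conv-cong : ∀ β m {X Y : ℕ → ℚ} s → (∀ r → r < s → X r ≡ Y r) → conv β m X s ≡ conv β m Y s
conv-cong β m {X} {Y} s X≡Y = ∑-cong′ m summand
  where
  summand : ∀ i → when (2 ℕ.* suc i ≤? s) (β (suc i) * X (s ∸ 2 ℕ.* suc i))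
                ≡ when (2 ℕ.* suc i ≤? s) (β (suc i) * Y (s ∸ 2 ℕ.* suc i))
  summand i with 2 ℕ.* suc i ≤? s
  ... | yes 2i≤s = cong (β (suc i) *_) (X≡Y _ (ℕ.∸-monoʳ-< (ℕ.z<s) 2i≤s))
  ... | no _     = refl

conv-zero : ∀ β m X → conv β m X 0 ≡ 0ℚ
conv-zero β m X = trans (∑-cong′ m (λ i → when-no (2 ℕ.* suc i ≤? 0) {β (suc i) * X 0} (λ ()))) (∑-zero m)

conv-∑ : ∀ β m n (w : ℕ → ℚ) (X : ℕ → ℕ → ℚ) s →
         conv β m (λ r → ∑[ j < n ] (w j * X j r)) s ≡ ∑[ j < n ] (w j * conv β m (X j) s)
conv-∑ β m n w X s = begin
  ∑[ i < m ] when (fits i) (β (suc i) * ∑[ j < n ] (w j * X j (r i)))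
    ≡⟨ ∑-cong′ m (λ i → pull-inside i) ⟩
  ∑[ i < m ] ∑[ j < n ] (w j * when (fits i) (β (suc i) * X j (r i)))
    ≡⟨ ∑-swap m n _ ⟩
  ∑[ j < n ] ∑[ i < m ] (w j * when (fits i) (β (suc i) * X j (r i)))
    ≡⟨ ∑-cong′ n (λ j → sym (*-distribˡ-∑ m (w j) _)) ⟩
  ∑[ j < n ] (w j * conv β m (X j) s)
    ∎
  where
  open ≡-Reasoning
  fits : ∀ i → Dec (2 ℕ.* suc i ≤ s)
  fits i = 2 ℕ.* suc i ≤? s
  r : ℕ → ℕ
  r i = s ∸ 2 ℕ.* suc i
  swap : ∀ b w x → b * (w * x) ≡ w * (b * x)
  swap = solve-∀ ℚ-ring
  pull-inside : ∀ i → when (fits i) (β (suc i) * ∑[ j < n ] (w j * X j (r i)))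
                    ≡ ∑[ j < n ] (w j * when (fits i) (β (suc i) * X j (r i)))
  pull-inside i = begin
    when (fits i) (β (suc i) * ∑[ j < n ] (w j * X j (r i)))
      ≡⟨ cong (when (fits i)) (*-distribˡ-∑ n (β (suc i)) _) ⟩
    when (fits i) (∑[ j < n ] (β (suc i) * (w j * X j (r i))))
      ≡⟨ sym (∑-when (fits i) n _) ⟩
    ∑[ j < n ] when (fits i) (β (suc i) * (w j * X j (r i)))
      ≡⟨ ∑-cong′ n (λ j → trans (cong (when (fits i)) (swap (β (suc i)) (w j) (X j (r i))))
                                (sym (*-when (fits i) (w j) _))) ⟩
    ∑[ j < n ] (w j * when (fits i) (β (suc i) * X j (r i)))
      ∎

-- Removing the constant term of Σ_i α i t^(2i) leaves only tuples with positive parts.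
nonConstant : (ℕ → ℚ) → ℕ → ℚ
nonConstant α zero    = 0ℚ
nonConstant α (suc i) = α (suc i)

Πℚ-nonConstant : ∀ α t → Πℚ (map (nonConstant α) t) ≡ when (all? (1 ≤?_) t) (Πℚ (map α t))
Πℚ-nonConstant α []          = refl
Πℚ-nonConstant α (zero ∷ t)  =
  trans (ℚ.*-zeroˡ (Πℚ (map (nonConstant α) t)))
        (sym (when-no (all? (1 ≤?_) (0 ∷ t)) {Πℚ (map α (0 ∷ t))} (λ { (() ∷ _) })))
Πℚ-nonConstant α (suc i ∷ t) = begin
  α (suc i) * Πℚ (map (nonConstant α) t)        ≡⟨ cong (α (suc i) *_) (Πℚ-nonConstant α t) ⟩
  α (suc i) * when (all? (1 ≤?_) t) (Πℚ (map α t)) ≡⟨ *-when (all? (1 ≤?_) t) (α (suc i)) _ ⟩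
  when (all? (1 ≤?_) t) (Πℚ (map α (suc i ∷ t)))  ≡⟨ when-⇔ (all? (1 ≤?_) t) (all? (1 ≤?_) (suc i ∷ t))
                                                       (mk⇔ (s≤s z≤n ∷_) (λ { (_ ∷ ps) → ps })) ⟩
  when (all? (1 ≤?_) (suc i ∷ t)) (Πℚ (map α (suc i ∷ t))) ∎
  where open ≡-Reasoning

compositionSum-nonConstant-suc : ∀ α m k s →
  compositionSum (nonConstant α) m (suc k) s ≡ conv α m (compositionSum (nonConstant α) m k) s
compositionSum-nonConstant-suc α m k s =
  trans (compositionSum-suc (nonConstant α) m k s)
        (trans (cong (_+ rest) (ℚ.*-zeroˡ (compositionSum (nonConstant α) m k s))) (ℚ.+-identityˡ rest))
  where
  rest : ℚ
  rest = conv α m (compositionSum (nonConstant α) m k) s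

-- A k-tuple with parts ≥ 0 is a j-tuple with positive parts with k - j zeros inserted.
compositionSum-binomial : ∀ α m → α 0 ≡ 1ℚ → ∀ k s →
  compositionSum α m k s ≡ binomialTransform (λ j → compositionSum (nonConstant α) m j s) k
compositionSum-binomial α m α0≡1 zero s = begin
  compositionSum α m 0 s                 ≡⟨ compositionSum-zero α m s ⟩
  when (0 ≟ s) 1ℚ                        ≡⟨ sym (compositionSum-zero (nonConstant α) m s) ⟩
  compositionSum (nonConstant α) m 0 s   ≡⟨ sym (binomialTransform-zero (λ j → compositionSum (nonConstant α) m j s)) ⟩
  binomialTransform (λ j → compositionSum (nonConstant α) m j s) 0 ∎
  where open ≡-Reasoning
compositionSum-binomial α m α0≡1 (suc k) s = begin
  compositionSum α m (suc k) s
    ≡⟨ compositionSum-suc α m k s ⟩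
  α 0 * Z k s + conv α m (Z k) s
    ≡⟨ cong (_+ conv α m (Z k) s) (trans (cong (_* Z k s) α0≡1) (ℚ.*-identityˡ (Z k s))) ⟩
  Z k s + conv α m (Z k) s
    ≡⟨ cong₂ _+_ (compositionSum-binomial α m α0≡1 k s)
                 (conv-cong α m s (λ r _ → compositionSum-binomial α m α0≡1 k r)) ⟩
  binomialTransform (λ j → P j s) k + conv α m (λ r → binomialTransform (λ j → P j r) k) s
    ≡⟨ cong (binomialTransform (λ j → P j s) k +_) (conv-∑ α m (suc k) (Cℚ k) P s) ⟩
  binomialTransform (λ j → P j s) k + binomialTransform (λ j → conv α m (P j) s) k
    ≡⟨ cong (binomialTransform (λ j → P j s) k +_)
            (binomialTransform-cong k (λ j → sym (compositionSum-nonConstant-suc α m j s))) ⟩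
  binomialTransform (λ j → P j s) k + binomialTransform (λ j → P (suc j) s) k
    ≡⟨ sym (binomialTransform-suc (λ j → P j s) k) ⟩
  binomialTransform (λ j → P j s) (suc k)
    ∎
  where
  open ≡-Reasoning
  Z P : ℕ → ℕ → ℚ
  Z = compositionSum α m
  P = compositionSum (nonConstant α) m

∑-alternating-binomial-compositionSum : ∀ α m n s → α 0 ≡ 1ℚ →
  ∑[ k < suc n ] (sgn k * (Cℚ (suc n) (suc k) * compositionSum α m k s))
    ≡ ∑[ j < suc n ] (sgn j * compositionSum (nonConstant α) m j s)
∑-alternating-binomial-compositionSum α m n s α0≡1 = begin
  ∑[ k < suc n ] (sgn k * (Cℚ (suc n) (suc k) * compositionSum α m k s))
    ≡⟨ ∑-cong (suc n) (λ k k≤n → expand k (ℕ.≤-pred k≤n)) ⟩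
  ∑[ k < suc n ] ∑[ j < suc n ] (sgn k * Cℚ (suc n) (suc k) * Cℚ k j * P j)
    ≡⟨ ∑-swap (suc n) (suc n) _ ⟩
  ∑[ j < suc n ] ∑[ k < suc n ] (sgn k * Cℚ (suc n) (suc k) * Cℚ k j * P j)
    ≡⟨ ∑-cong (suc n) (λ j j≤n → trans (sym (*-distribʳ-∑ (suc n) (P j) _))
                                       (cong (_* P j) (∑-alternating-binomial (ℕ.≤-pred j≤n)))) ⟩
  ∑[ j < suc n ] (sgn j * P j)
    ∎
  where
  open ≡-Reasoning
  P : ℕ → ℚ
  P j = compositionSum (nonConstant α) m j s
  expand : ∀ k → k ≤ n → sgn k * (Cℚ (suc n) (suc k) * compositionSum α m k s)
                         ≡ ∑[ j < suc n ] (sgn k * Cℚ (suc n) (suc k) * Cℚ k j * P j)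
  expand k k≤n = begin
    sgn k * (Cℚ (suc n) (suc k) * compositionSum α m k s)
      ≡⟨ sym (ℚ.*-assoc (sgn k) _ _) ⟩
    sgn k * Cℚ (suc n) (suc k) * compositionSum α m k s
      ≡⟨ cong (sgn k * Cℚ (suc n) (suc k) *_) (trans (compositionSum-binomial α m α0≡1 k s)
                                                     (binomialTransform-extend P k≤n)) ⟩
    sgn k * Cℚ (suc n) (suc k) * ∑[ j < suc n ] (Cℚ k j * P j)
      ≡⟨ *-distribˡ-∑ (suc n) (sgn k * Cℚ (suc n) (suc k)) (λ j → Cℚ k j * P j) ⟩
    ∑[ j < suc n ] (sgn k * Cℚ (suc n) (suc k) * (Cℚ k j * P j))
      ≡⟨ ∑-cong′ (suc n) (λ j → sym (ℚ.*-assoc (sgn k * Cℚ (suc n) (suc k)) (Cℚ k j) (P j))) ⟩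
    ∑[ j < suc n ] (sgn k * Cℚ (suc n) (suc k) * Cℚ k j * P j)
      ∎

-- The reciprocal series

c-even : ∀ N q → c N (2 ℕ.* q) ≡ a N q
c-even N q rewrite trans (cong (ℕ._% 2) (ℕ.*-comm 2 q)) (ℕ.m*n%n≡0 q 2)
                 | trans (cong (ℕ._/ 2) (ℕ.*-comm 2 q)) (ℕ.m*n/n≡m q 2) = refl

c-odd : ∀ N q → c N (suc (2 ℕ.* q)) ≡ 0ℚ
c-odd N q rewrite trans (cong (λ n → suc n ℕ.% 2) (ℕ.*-comm 2 q)) (ℕ.[m+kn]%n≡m%n 1 q 2) = refl

a-zero : ∀ N → a N 0 ≡ 1ℚ
a-zero N = trans (ℚ./-cong {ℤ.+ F} {_} {ℤ.+ F} {F} {{(2 ℕ.* N ℕ.+ 0 ℕ.+ 1) !≢0}} {{F≢0}} refl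
                   (cong (λ n → (n ℕ.+ 1) !) (ℕ.+-identityʳ (2 ℕ.* N))))
                 (n/n≡1 F {{F≢0}})
  where
  F : ℕ
  F = (2 ℕ.* N ℕ.+ 1) !
  F≢0 : ℕ.NonZero F
  F≢0 = (2 ℕ.* N ℕ.+ 1) !≢0

b : ℕ → ℕ → ℚ
b N n = fromMaybe 0ℚ (head (bs N n))

bs≡applyDownFrom : ∀ N n → bs N n ≡ applyDownFrom (b N) (suc n)
bs≡applyDownFrom N zero    = refl
bs≡applyDownFrom N (suc n) = cong (b N (suc n) ∷_) (bs≡applyDownFrom N n)

Σℚ-zipWith-applyDownFrom : ∀ (f g : ℕ → ℚ) n →
  Σℚ (zipWith _*_ (applyUpTo f (suc n)) (applyDownFrom g (suc n))) ≡ ∑[ j < suc n ] (f j * g (n ∸ j))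
Σℚ-zipWith-applyDownFrom f g zero = begin
  f 0 * g 0 + 0ℚ     ≡⟨ cong (f 0 * g 0 +_) (sym (∑-empty _)) ⟩
  f 0 * g 0 + ∑ 0 _  ≡⟨ sym (∑-suc 0 _) ⟩
  ∑[ j < 1 ] (f j * g (0 ∸ j)) ∎
  where open ≡-Reasoning
Σℚ-zipWith-applyDownFrom f g (suc n) =
  trans (cong (f 0 * g (suc n) +_) (Σℚ-zipWith-applyDownFrom (f ∘ suc) g n)) (sym (∑-suc (suc n) _))

b-recurrence : ∀ N n → b N (suc n) ≡ - ∑[ j < suc n ] (c N (suc j) * b N (n ∸ j))
b-recurrence N n = cong -_ (begin
  Σℚ (zipWith _*_ (map (c N) (map suc (upTo (suc n)))) (bs N n))
    ≡⟨ cong₂ (λ xs ys → Σℚ (zipWith _*_ xs ys))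
             (trans (sym (map-∘ (upTo (suc n)))) (map-upTo (c N ∘ suc) (suc n)))
             (bs≡applyDownFrom N n) ⟩
  Σℚ (zipWith _*_ (applyUpTo (c N ∘ suc) (suc n)) (applyDownFrom (b N) (suc n)))
    ≡⟨ Σℚ-zipWith-applyDownFrom (c N ∘ suc) (b N) n ⟩
  ∑[ j < suc n ] (c N (suc j) * b N (n ∸ j))
    ∎)
  where open ≡-Reasoning

b-conv : ∀ N m s → ⌊ suc s /2⌋ ≤ m → b N (suc s) ≡ - conv (a N) m (b N) (suc s)
b-conv N m s ⌊s/2⌋≤m = trans (b-recurrence N s) (cong -_ (begin
  ∑[ j < suc s ] h (suc j)
    ≡⟨ ∑-odd-vanishing (suc s) h h-odd ⟩
  ∑[ i < ⌊ suc s /2⌋ ] h (2 ℕ.* suc i)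
    ≡⟨ ∑-cong′ ⌊ suc s /2⌋ (λ i → cong (_* b N (suc s ∸ 2 ℕ.* suc i)) (c-even N (suc i))) ⟩
  ∑[ i < ⌊ suc s /2⌋ ] (a N (suc i) * b N (suc s ∸ 2 ℕ.* suc i))
    ≡⟨ sym (∑-when-double≤ m (suc s) _ ⌊s/2⌋≤m) ⟩
  conv (a N) m (b N) (suc s)
    ∎))
  where
  open ≡-Reasoning
  h : ℕ → ℚ
  h j = c N j * b N (suc s ∸ j)
  h-odd : ∀ q → h (suc (2 ℕ.* q)) ≡ 0ℚ
  h-odd q = trans (cong (_* b N (s ∸ 2 ℕ.* q)) (c-odd N q)) (ℚ.*-zeroˡ (b N (s ∸ 2 ℕ.* q)))

-- b_s = -(conv b)_s, and conv turns the alternating sum over at most K parts into minus the one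
-- over at most K + 1 parts, up to its (vanishing) term with no parts.
b≡∑-alternating-compositionSum : ∀ N m K s → s ≤ K → ⌊ s /2⌋ ≤ m →
  b N s ≡ ∑[ k < suc K ] (sgn k * compositionSum (nonConstant (a N)) m k s)
b≡∑-alternating-compositionSum N m K zero _ _ = sym (begin
  ∑[ k < suc K ] (sgn k * P k 0)                    ≡⟨ ∑-suc K _ ⟩
  1ℚ * P 0 0 + ∑[ k < K ] (sgn (suc k) * P (suc k) 0) ≡⟨ cong₂ _+_ P₀ (trans (∑-cong′ K P₊) (∑-zero K)) ⟩
  1ℚ + 0ℚ                                            ≡⟨ ℚ.+-identityʳ 1ℚ ⟩
  1ℚ                                                 ∎)
  where
  open ≡-Reasoning
  P : ℕ → ℕ → ℚ
  P = compositionSum (nonConstant (a N)) m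
  P₀ : 1ℚ * P 0 0 ≡ 1ℚ
  P₀ = trans (ℚ.*-identityˡ (P 0 0)) (trans (compositionSum-zero (nonConstant (a N)) m 0) (when-yes (0 ≟ 0) refl))
  P₊ : ∀ k → sgn (suc k) * P (suc k) 0 ≡ 0ℚ
  P₊ k = trans (cong (sgn (suc k) *_) (trans (compositionSum-nonConstant-suc (a N) m k 0) (conv-zero (a N) m (P k))))
               (ℚ.*-zeroʳ (sgn (suc k)))
b≡∑-alternating-compositionSum N m (suc K) (suc s) (s≤s s≤K) ⌊s/2⌋≤m = begin
  b N (suc s)
    ≡⟨ b-conv N m s ⌊s/2⌋≤m ⟩
  - conv (a N) m (b N) (suc s)
    ≡⟨ cong -_ (conv-cong (a N) m (suc s) (λ r r<s → b≡∑-alternating-compositionSum N m K r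
                 (ℕ.≤-trans (ℕ.≤-pred r<s) s≤K) (ℕ.≤-trans (ℕ.⌊n/2⌋-mono (ℕ.<⇒≤ r<s)) ⌊s/2⌋≤m))) ⟩
  - conv (a N) m (λ r → ∑[ k < suc K ] (sgn k * P k r)) (suc s)
    ≡⟨ cong -_ (conv-∑ (a N) m (suc K) sgn P (suc s)) ⟩
  - ∑[ k < suc K ] (sgn k * conv (a N) m (P k) (suc s))
    ≡⟨ -‿distrib-∑ (suc K) _ ⟩
  ∑[ k < suc K ] (- (sgn k * conv (a N) m (P k) (suc s)))
    ≡⟨ ∑-cong′ (suc K) (λ k → trans (ℚ.neg-distribˡ-* (sgn k) _)
                                     (cong (sgn (suc k) *_) (sym (compositionSum-nonConstant-suc (a N) m k (suc s))))) ⟩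
  ∑[ k < suc K ] (sgn (suc k) * P (suc k) (suc s))
    ≡⟨ sym (trans (cong (_+ rest) P₀) (ℚ.+-identityˡ rest)) ⟩
  1ℚ * P 0 (suc s) + rest
    ≡⟨ sym (∑-suc (suc K) _) ⟩
  ∑[ k < suc (suc K) ] (sgn k * P k (suc s))
    ∎
  where
  open ≡-Reasoning
  P : ℕ → ℕ → ℚ
  P = compositionSum (nonConstant (a N)) m
  rest : ℚ
  rest = ∑[ k < suc K ] (sgn (suc k) * P (suc k) (suc s))
  P₀ : 1ℚ * P 0 (suc s) ≡ 0ℚ
  P₀ = trans (ℚ.*-identityˡ (P 0 (suc s))) (compositionSum-zero-suc (nonConstant (a N)) m s)

Σℚ-posTuples : ∀ N k n → Σℚ (map (term N) (posTuples k n)) ≡ compositionSum (nonConstant (a N)) n k n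
Σℚ-posTuples N k n = begin
  Σℚ (map (term N) (posTuples k n))
    ≡⟨ Σℚ-filter (λ t → (2 ℕ.* sumℕ t ≟ n) ×-dec all? (1 ≤?_) t) (term N) (tuples k n) ⟩
  Σℚ (map (λ t → when ((2 ℕ.* sumℕ t ≟ n) ×-dec all? (1 ≤?_) t) (term N t)) (tuples k n))
    ≡⟨ cong Σℚ (map-cong (λ t → trans (when-× (2 ℕ.* sumℕ t ≟ n) (all? (1 ≤?_) t) (term N t))
                                      (cong (when (2 ℕ.* sumℕ t ≟ n)) (sym (Πℚ-nonConstant (a N) t))))
                         (tuples k n)) ⟩
  Σℚ (map (λ t → when (2 ℕ.* sumℕ t ≟ n) (Πℚ (map (nonConstant (a N)) t))) (tuples k n))
    ≡⟨ sym (Σℚ-filter (λ t → 2 ℕ.* sumℕ t ≟ n) (λ t → Πℚ (map (nonConstant (a N)) t)) (tuples k n)) ⟩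
  compositionSum (nonConstant (a N)) n k n
    ∎
  where open ≡-Reasoning

b≡∑-positive-compositions : ∀ N n →
  b N (suc n) ≡ Σℚ (map (λ k → sgn k * Σℚ (map (term N) (posTuples k (suc n)))) (range1 (suc n)))
b≡∑-positive-compositions N n = begin
  b N (suc n)
    ≡⟨ b≡∑-alternating-compositionSum N (suc n) (suc n) (suc n) ℕ.≤-refl (ℕ.⌊n/2⌋≤n (suc n)) ⟩
  ∑[ k < suc (suc n) ] (sgn k * P k)
    ≡⟨ ∑-drop-first (suc n) _ (trans (cong (1ℚ *_) (compositionSum-zero-suc (nonConstant (a N)) (suc n) n))
                                     (ℚ.*-zeroʳ 1ℚ)) ⟩
  ∑[ k < suc n ] (sgn (suc k) * P (suc k))
    ≡⟨ ∑-cong′ (suc n) (λ k → cong (sgn (suc k) *_) (sym (Σℚ-posTuples N (suc k) (suc n)))) ⟩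
  ∑[ k < suc n ] (sgn (suc k) * Σℚ (map (term N) (posTuples (suc k) (suc n))))
    ≡⟨ sym (Σℚ-range1 (suc n) (λ k → sgn k * Σℚ (map (term N) (posTuples k (suc n))))) ⟩
  Σℚ (map (λ k → sgn k * Σℚ (map (term N) (posTuples k (suc n)))) (range1 (suc n)))
    ∎
  where
  open ≡-Reasoning
  P : ℕ → ℚ
  P k = compositionSum (nonConstant (a N)) (suc n) k (suc n)

b≡∑-binomial-compositions : ∀ N n →
  b N (suc n) ≡ Σℚ (map (λ k → sgn k * (Cℚ (suc (suc n)) (suc k) * Σℚ (map (term N) (natTuples k (suc n)))))
                       (range1 (suc n)))
b≡∑-binomial-compositions N n = begin
  b N (suc n)
    ≡⟨ b≡∑-alternating-compositionSum N (suc n) (suc n) (suc n) ℕ.≤-refl (ℕ.⌊n/2⌋≤n (suc n)) ⟩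
  ∑[ j < suc (suc n) ] (sgn j * compositionSum (nonConstant (a N)) (suc n) j (suc n))
    ≡⟨ sym (∑-alternating-binomial-compositionSum (a N) (suc n) (suc n) (suc n) (a-zero N)) ⟩
  ∑[ k < suc (suc n) ] (sgn k * (Cℚ (suc (suc n)) (suc k) * Z k))
    ≡⟨ ∑-drop-first (suc n) _ (trans (cong (λ z → 1ℚ * (Cℚ (suc (suc n)) 1 * z))
                                           (compositionSum-zero-suc (a N) (suc n) n))
                                     (vanish (Cℚ (suc (suc n)) 1))) ⟩
  ∑[ k < suc n ] (sgn (suc k) * (Cℚ (suc (suc n)) (suc (suc k)) * Z (suc k)))
    ≡⟨ sym (Σℚ-range1 (suc n) (λ k → sgn k * (Cℚ (suc (suc n)) (suc k) * Z k))) ⟩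
  Σℚ (map (λ k → sgn k * (Cℚ (suc (suc n)) (suc k) * Z k)) (range1 (suc n)))
    ∎
  where
  open ≡-Reasoning
  Z : ℕ → ℚ
  Z k = compositionSum (a N) (suc n) k (suc n)
  vanish : ∀ x → 1ℚ * (x * 0ℚ) ≡ 0ℚ
  vanish = solve-∀ ℚ-ring

theorem5 : (N n : ℕ) → 1 ≤ n → (Ehat N n ≡ rhs₁ N n) × (Ehat N n ≡ rhs₂ N n)
theorem5 N (suc n) _ = cong (ι (suc n !) *_) (b≡∑-positive-compositions N n)
                     , cong (ι (suc n !) *_) (b≡∑-binomial-compositions N n)
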